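{- The generating functions $G_{ab}(x,u,q)$ for $a,b\in\{0,1\}$ satisfy the following system of functional equations: \[ \begin{aligned} G_{00}(x,u,q)&=\frac{xuq}{qu-1}\left(G_{10}(x,qu,q)-G_{10}(x,1,q)+G_{11}(x,qu,q)-G_{11}(x,1,q)\right),\\ G_{01}(x,u,q)&=\frac{xu}{qu-1}\left(uqG_{10}(x,qu,q)-G_{10}(x,1,q)+G_{11}(x,qu,q)-G_{11}(x,1,q)\right),\\ G_{10}(x,u,q)&=\frac{xuq}{qu-1}\left(G_{00}(x,qu,q)-G_{00}(x,1,q)+G_{01}(x,qu,q)-G_{01}(x,1,q)\right),\\ G_{11}(x,u,q)&=xuq+\frac{xuq}{qu-1}\left(uqG_{00}(x,qu,q)-G_{00}(x,1,q)+G_{01}(x,qu,q)-G_{01}(x,1,q)\right), \end{aligned} \] which is equivalent to the matrix equation \[ \mathbf{G}(x,u,q)=\mathbf{M}(x,u,q)\cdot \mathbf{G}(x,qu,q)-\mathbf{N}(x,u,q)\cdot \mathbf{G}(x,1,q)+\mathbf{B}(x,u,q), \] where \[\mathbf{M}(x,u,q)= \begin{pmatrix} 0& 0 & \frac{xuq}{qu-1} & \frac{xuq}{qu-1} \\ 0& 0 & \frac{xu^2q}{qu-1} & \frac{xu}{qu-1}\\ \frac{xuq}{qu-1} & \frac{xuq}{qu-1} & 0 & 0 \\ \frac{xu^2q^2}{qu-1} & \frac{xuq}{qu-1} & 0 & 0 \end{pmatrix}, \quad \mathbf{N}(x,u,q)= \begin{pmatrix} 0& 0 & \frac{xuq}{qu-1}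 & \frac{xuq}{qu-1} \\ 0& 0 & \frac{xu}{qu-1} & \frac{xu}{qu-1}\\ \frac{xuq}{qu-1} & \frac{xuq}{qu-1} & 0 & 0 \\ \frac{xuq}{qu-1} & \frac{xuq}{qu-1} & 0 & 0 \end{pmatrix}, \quad \mathbf{B}(x,u,q)= \begin{pmatrix} 0\\ 0\\ 0\\ xuq \end{pmatrix}. \]
   Context: A Catalan word is a sequence $w_1\cdots w_n$ of nonnegative integers with $w_1=0$ and $w_i\le w_{i-1}+1$. Its Catalan polyomino $P$ has, at position $i$, a column of $w_i+1$ cells, all columns bottom-aligned. Cells are colored in a chessboard pattern with the southwestern cell black; $\mathrm{bck}(P)$ is the number of black cells, $\mathrm{len}(P)$ the number of columns, and $\mathrm{last}(P)$ the number of cells in the last column. For $a,b\in\{0,1\}$, $F_{ab}(x,u,q)=\sum_P x^{\mathrm{len}(P)}u^{\mathrm{last}(P)}q^{\mathrm{bck}(P)}$, summed over Catalan polyominoes with $\mathrm{len}(P)\equiv a$ and $\mathrm{last}(P)\equiv b \pmod 2$. Define $G_{00}(x,u,q)=F_{00}(x,\sqrt{u},q)$, $G_{01}(x,u,q)=\sqrt{u}F_{01}(x,\sqrt{u},q)$, $G_{10}(x,u,q)=F_{10}(x,\sqrt{u},q)$, $G_{11}(x,u,q)=\sqrt{u}F_{11}(x,\sqrt{u},q)$, and $\mathbf{G}(x,u,q)=(G_{00},G_{01},G_{10},G_{11})^T(x,u,q)$. -}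

module Defs where

open import Data.Nat.Base using (ℕ; zero; suc) renaming (_+_ to _+ℕ_)
open import Data.Nat.Base using ( _≤ᵇ_; _≡ᵇ_; ⌊_/2⌋)
open import Data.Bool.Base using (Bool; true; false; _∧_; if_then_else_)
open import Data.List.Base using (List; []; _∷_; map; concatMap; filterᵇ; upTo; length)
open import Algebra.Bundles using (CommutativeRing)

-- Parity as a Boolean: parity n = true iff n is odd (so false ↔ 0, true ↔ 1 mod 2).
parity : ℕ → Bool
parity zero = false
parity (suc zero) = true
parity (suc (suc n)) = parity n

_==B_ : Bool → Bool → Bool
false ==B false = true
true  ==B true  = true
_     ==B _     = false

stepsOK : ℕ → List ℕ → Bool
stepsOK p [] = true
stepsOK p (w ∷ ws) = (w ≤ᵇ suc p) ∧ stepsOK w ws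

isCatalan : List ℕ → Bool
isCatalan [] = false
isCatalan (w ∷ ws) = (w ≡ᵇ 0) ∧ stepsOK w ws

allWords : ℕ → ℕ → List (List ℕ)
allWords zero m = [] ∷ []
allWords (suc n) m = concatMap (λ k → map (k ∷_) (allWords n m)) (upTo m)

-- Catalan words of length n (their entries are all ≤ n-1, so this enumerates all of them).
catalanWords : ℕ → List (List ℕ)
catalanWords n = filterᵇ isCatalan (allWords n n)

len : List ℕ → ℕ
len = length

-- last(P): number of cells of the last column = (last letter) + 1.
lastP : List ℕ → ℕ
lastP [] = 0
lastP (w ∷ []) = suc w
lastP (w ∷ v ∷ ws) = lastP (v ∷ ws)

-- Cells are (i , j), column i ≥ 1, row j ≥ 1; (1,1) (southwest) is black,
-- chessboard colouring: (i , j) black iff i + j even.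
blackInColumn : ℕ → ℕ → ℕ
blackInColumn i zero = 0
blackInColumn i (suc h) = blackInColumn i h +ℕ (if parity (i +ℕ suc h) then 0 else 1)

bckFrom : ℕ → List ℕ → ℕ
bckFrom i [] = 0
bckFrom i (w ∷ ws) = blackInColumn i (suc w) +ℕ bckFrom (suc i) ws

bck : List ℕ → ℕ
bck = bckFrom 1

-- Generating functions, coefficientwise in x, with u, q evaluated in an
-- arbitrary commutative ring (equivalently: identities in ℤ[u,q][[x]]).
module GF {c ℓ} (R : CommutativeRing c ℓ) where
  open CommutativeRing R

  pow : Carrier → ℕ → Carrier
  pow a zero = 1#
  pow a (suc n) = a * pow a n

  sumR : List Carrier → Carrier
  sumR [] = 0#
  sumR (a ∷ as) = a + sumR as

  -- Exponent of u after the substitution u ↦ √u: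
  --   G_{a0} = F_{a0}(x,√u,q): √u^last = u^(last/2)   (last even)
  --   G_{a1} = √u F_{a1}(x,√u,q): √u^(last+1) = u^((last+1)/2)   (last odd)
  uExp : Bool → ℕ → ℕ
  uExp false L = ⌊ L /2⌋
  uExp true  L = ⌊ suc L /2⌋

  G : Bool → Bool → ℕ → Carrier → Carrier → Carrier
  G a b n u q =
    sumR (map (λ w → pow u (uExp b (lastP w)) * pow q (bck w))
              (filterᵇ (λ w → (parity (len w) ==B a) ∧ (parity (lastP w) ==B b))
                       (catalanWords n)))

  xTimes : (ℕ → Carrier) → ℕ → Carrier
  xTimes f zero = 0#
  xTimes f (suc n) = f n

  xMono : Carrier → ℕ → Carrier
  xMono a (suc zero) = a
  xMono a _ = 0#

-- A Catalan word of length n + 2 is a Catalan word w of length n + 1 followed by a letter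
-- j ≤ w_last + 1: the polyomino of w gets a new column of height h ≤ last(w) + 1 at position
-- n + 2, and the parity of the length flips.  By the chessboard colouring a column of height
-- h + 2 weighs qu times a column of height h, so the new column contributes one geometric
-- progression of ratio qu over the even heights and one over the odd heights.  Multiplied by
-- qu − 1 they telescope to uq((qu)^⌈L/2⌉ − 1) and uq^β((qu)^⌈(L+1)/2⌉ − 1), with L = last(w)
-- and β ∈ {0, 1} the colour of the new bottom cell.  Up to the factor q^bck(w), (qu)^⌈L/2⌉ is
-- the contribution of w to G_{a0}(x, qu, q) + G_{a1}(x, qu, q), (qu)^⌈(L+1)/2⌉ its contribution
-- to uq·G_{a0}(x, qu, q) + G_{a1}(x, qu, q), and the subtracted 1 its contribution at u = 1.
module Submission where

open import Defs
open import Data.Nat.Base using (ℕ)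
open import Data.Bool.Base using (false; true)
open import Data.Product using (_×_)
open import Algebra.Bundles using (CommutativeRing)

open import Data.Bool.Base using (Bool; T; not; _∧_; if_then_else_)
open import Data.Bool.Properties using (∧-assoc; ∧-identityʳ; T-∧)
open import Data.Empty using (⊥-elim)
open import Data.Integer.Base using (0ℤ; 1ℤ)
open import Data.List.Base using (List; []; _∷_; _++_; _∷ʳ_; [_]; map; concatMap; filterᵇ; upTo; length)
open import Data.List.Properties using (length-++; map-∘; map-applyUpTo; map-upTo; upTo-∷ʳ)
open import Data.List.Membership.Propositional using (_∈_)
open import Data.List.Membership.Propositional.Properties using (∈-++⁺ʳ)
open import Data.List.Relation.Unary.Any using (here; there)
open import Data.Nat.Base as ℕ using (zero; suc; _≤_; _<_; _≤ᵇ_; _≡ᵇ_; s≤s; ⌊_/2⌋; ⌈_/2⌉)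
open import Data.Nat.Properties using (≤-refl; ≤-pred; <-irrefl; m≤m+n; +-monoˡ-≤; ≤ᵇ⇒≤; ≤⇒≤ᵇ; ≡ᵇ⇒≡)
open import Data.Product using (_,_)
open import Function.Base using (_∘_)
open import Function.Bundles using (Equivalence)
import Relation.Binary.PropositionalEquality as ≡
open ≡ using (_≡_; refl)

-- Algebra.Solver.Ring needs a coefficient ring with decidable equality mapping into the
-- carrier; ℤ, the initial ring, serves every commutative ring.
module IntegerCoefficients {c ℓ} (R : CommutativeRing c ℓ) where
  open CommutativeRing R hiding (zero) renaming (refl to ≈-refl)
  open import Algebra.Properties.Ring ring using (-0#≈0#; -‿involutive; -‿+-comm; -‿distribˡ-*; -‿distribʳ-*)
  open import Algebra.Properties.Semiring.Mult.TCOptimised semiring using (×-homo-+; ×1-homo-*)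
    renaming (_×_ to _·_)
  open import Algebra.Solver.Ring.AlmostCommutativeRing using (_-Raw-AlmostCommutative⟶_; fromCommutativeRing)
  open import Data.Integer.Base as ℤ using (ℤ; +_; -[1+_]; _⊖_)
  open import Data.Integer.Properties using (_≟_; [1+m]⊖[1+n]≡m⊖n; +◃n≡+n; -◃n≡-n)
  open import Data.Maybe.Base as Maybe using ()
  open import Data.Nat.Properties using (+-suc)
  import Data.Sign.Base as Sign
  open import Relation.Binary.Consequences using (dec⇒weaklyDec)
  open import Relation.Binary.Reasoning.Setoid setoid

  fromℤ : ℤ → Carrier
  fromℤ (+ n)    = n · 1#
  fromℤ -[1+ n ] = - (suc n · 1#)

  fromℤ-homo-neg : ∀ i → fromℤ (ℤ.- i) ≈ - fromℤ i
  fromℤ-homo-neg (+ zero)  = sym -0#≈0#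
  fromℤ-homo-neg (+ suc n) = ≈-refl
  fromℤ-homo-neg -[1+ n ]  = sym (-‿involutive _)

  x-y≈[z+x]-[z+y] : ∀ x y z → x - y ≈ (z + x) - (z + y)
  x-y≈[z+x]-[z+y] x y z = sym (begin
    (z + x) - (z + y)     ≈⟨ +-congˡ (-‿+-comm z y) ⟨
    (z + x) + (- z - y)   ≈⟨ +-congʳ (+-comm z x) ⟩
    (x + z) + (- z - y)   ≈⟨ +-assoc x z _ ⟩
    x + (z + (- z - y))   ≈⟨ +-congˡ (+-assoc z (- z) (- y)) ⟨
    x + ((z - z) - y)     ≈⟨ +-congˡ (+-congʳ (-‿inverseʳ z)) ⟩
    x + (0# - y)          ≈⟨ +-congˡ (+-identityˡ (- y)) ⟩
    x - y                 ∎)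

  fromℤ-⊖ : ∀ m n → fromℤ (m ⊖ n) ≈ m · 1# - n · 1#
  fromℤ-⊖ m       zero    = sym (trans (+-congˡ -0#≈0#) (+-identityʳ _))
  fromℤ-⊖ zero    (suc n) = sym (+-identityˡ _)
  fromℤ-⊖ (suc m) (suc n) = begin
    fromℤ (suc m ⊖ suc n)          ≡⟨ ≡.cong fromℤ ([1+m]⊖[1+n]≡m⊖n m n) ⟩
    fromℤ (m ⊖ n)                  ≈⟨ fromℤ-⊖ m n ⟩
    m · 1# - n · 1#                ≈⟨ x-y≈[z+x]-[z+y] _ _ 1# ⟩
    (1# + m · 1#) - (1# + n · 1#)  ≈⟨ +-cong (×-homo-+ 1# 1 m) (-‿cong (×-homo-+ 1# 1 n)) ⟨
    suc m · 1# - suc n · 1#        ∎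

  fromℤ-homo-+ : ∀ i j → fromℤ (i ℤ.+ j) ≈ fromℤ i + fromℤ j
  fromℤ-homo-+ (+ m)    (+ n)    = ×-homo-+ 1# m n
  fromℤ-homo-+ (+ m)    -[1+ n ] = fromℤ-⊖ m (suc n)
  fromℤ-homo-+ -[1+ m ] (+ n)    = trans (fromℤ-⊖ n (suc m)) (+-comm _ _)
  fromℤ-homo-+ -[1+ m ] -[1+ n ] = begin
    - (suc (suc m ℕ.+ n) · 1#)       ≡⟨ ≡.cong (λ k → - (suc k · 1#)) (+-suc m n) ⟨
    - ((suc m ℕ.+ suc n) · 1#)       ≈⟨ -‿cong (×-homo-+ 1# (suc m) (suc n)) ⟩
    - (suc m · 1# + suc n · 1#)      ≈⟨ -‿+-comm _ _ ⟨
    - (suc m · 1#) + - (suc n · 1#)  ∎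

  fromℤ-homo-* : ∀ i j → fromℤ (i ℤ.* j) ≈ fromℤ i * fromℤ j
  fromℤ-homo-* (+ m) (+ n) = begin
    fromℤ (Sign.+ ℤ.◃ (m ℕ.* n))  ≡⟨ ≡.cong fromℤ (+◃n≡+n (m ℕ.* n)) ⟩
    (m ℕ.* n) · 1#                ≈⟨ ×1-homo-* m n ⟩
    m · 1# * n · 1#               ∎
  fromℤ-homo-* (+ m) -[1+ n ] = begin
    fromℤ (Sign.- ℤ.◃ (m ℕ.* suc n))  ≡⟨ ≡.cong fromℤ (-◃n≡-n (m ℕ.* suc n)) ⟩
    fromℤ (ℤ.- (+ (m ℕ.* suc n)))     ≈⟨ fromℤ-homo-neg (+ (m ℕ.* suc n)) ⟩
    - ((m ℕ.* suc n) · 1#)            ≈⟨ -‿cong (×1-homo-* m (suc n)) ⟩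
    - (m · 1# * suc n · 1#)           ≈⟨ -‿distribʳ-* _ _ ⟩
    m · 1# * - (suc n · 1#)           ∎
  fromℤ-homo-* -[1+ m ] (+ n) = begin
    fromℤ (Sign.- ℤ.◃ (suc m ℕ.* n))  ≡⟨ ≡.cong fromℤ (-◃n≡-n (suc m ℕ.* n)) ⟩
    fromℤ (ℤ.- (+ (suc m ℕ.* n)))     ≈⟨ fromℤ-homo-neg (+ (suc m ℕ.* n)) ⟩
    - ((suc m ℕ.* n) · 1#)            ≈⟨ -‿cong (×1-homo-* (suc m) n) ⟩
    - (suc m · 1# * n · 1#)           ≈⟨ -‿distribˡ-* _ _ ⟩
    - (suc m · 1#) * n · 1#           ∎
  fromℤ-homo-* -[1+ m ] -[1+ n ] = begin
    fromℤ (Sign.+ ℤ.◃ (suc m ℕ.* suc n))  ≡⟨ ≡.cong fromℤ (+◃n≡+n (suc m ℕ.* suc n)) ⟩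
    (suc m ℕ.* suc n) · 1#                ≈⟨ ×1-homo-* (suc m) (suc n) ⟩
    suc m · 1# * suc n · 1#               ≈⟨ -‿involutive _ ⟨
    - - (suc m · 1# * suc n · 1#)         ≈⟨ -‿cong (-‿distribˡ-* _ _) ⟩
    - (- (suc m · 1#) * suc n · 1#)       ≈⟨ -‿distribʳ-* _ _ ⟩
    - (suc m · 1#) * - (suc n · 1#)       ∎

  fromℤ-morphism : ℤ.+-*-rawRing -Raw-AlmostCommutative⟶ fromCommutativeRing R
  fromℤ-morphism = record
    { ⟦_⟧    = fromℤ
    ; +-homo = fromℤ-homo-+
    ; *-homo = fromℤ-homo-*
    ; -‿homo = fromℤ-homo-neg
    ; 0-homo = ≈-refl
    ; 1-homo = ≈-refl
    }

  open import Algebra.Solver.Ring ℤ.+-*-rawRing (fromCommutativeRing R) fromℤ-morphism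
    (λ i j → Maybe.map (reflexive ∘ ≡.cong fromℤ) (dec⇒weaklyDec _≟_ i j)) public
    using (solve; _:=_; _:+_; _:*_; _:-_; con)

-- Catalan words and the chessboard colouring

module _ where
  open import Data.Nat.Base using (_+_)
  open import Data.Nat.Properties using (+-comm; +-assoc; +-suc; +-identityʳ; module ≤-Reasoning)
  open ≡ using (sym; trans; cong; subst; module ≡-Reasoning)

  stepsOK-∷ʳ : ∀ p xs j → stepsOK p (xs ∷ʳ j) ≡ stepsOK p xs ∧ (j ≤ᵇ lastP (p ∷ xs))
  stepsOK-∷ʳ p []       j = ∧-identityʳ _
  stepsOK-∷ʳ p (y ∷ ys) j =
    trans (cong ((y ≤ᵇ suc p) ∧_) (stepsOK-∷ʳ y ys j)) (sym (∧-assoc (y ≤ᵇ suc p) _ _))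

  isCatalan-∷ʳ : ∀ x xs j → isCatalan (x ∷ xs ∷ʳ j) ≡ isCatalan (x ∷ xs) ∧ (j ≤ᵇ lastP (x ∷ xs))
  isCatalan-∷ʳ x xs j =
    trans (cong ((x ≡ᵇ 0) ∧_) (stepsOK-∷ʳ x xs j)) (sym (∧-assoc (x ≡ᵇ 0) _ _))

  length-∷ʳ : ∀ (w : List ℕ) j → length (w ∷ʳ j) ≡ suc (length w)
  length-∷ʳ w j = trans (length-++ w) (+-comm (length w) 1)

  lastP-∷ʳ : ∀ w j → lastP (w ∷ʳ j) ≡ suc j
  lastP-∷ʳ []           j = refl
  lastP-∷ʳ (x ∷ [])     j = refl
  lastP-∷ʳ (x ∷ y ∷ ys) j = lastP-∷ʳ (y ∷ ys) j

  bckFrom-∷ʳ : ∀ i w j → bckFrom i (w ∷ʳ j) ≡ bckFrom i w + blackInColumn (i + length w) (suc j)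
  bckFrom-∷ʳ i [] j = begin
    blackInColumn i (suc j) + 0    ≡⟨ +-identityʳ _ ⟩
    blackInColumn i (suc j)        ≡⟨ cong (λ k → blackInColumn k (suc j)) (+-identityʳ i) ⟨
    blackInColumn (i + 0) (suc j)  ∎
    where open ≡-Reasoning
  bckFrom-∷ʳ i (x ∷ xs) j = begin
    b + bckFrom (suc i) (xs ∷ʳ j)                                         ≡⟨ cong (b +_) (bckFrom-∷ʳ (suc i) xs j) ⟩
    b + (bckFrom (suc i) xs + blackInColumn (suc i + length xs) (suc j))  ≡⟨ +-assoc b _ _ ⟨
    b + bckFrom (suc i) xs + blackInColumn (suc i + length xs) (suc j)
      ≡⟨ cong (λ k → b + bckFrom (suc i) xs + blackInColumn k (suc j)) (+-suc i (length xs)) ⟨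
    b + bckFrom (suc i) xs + blackInColumn (i + suc (length xs)) (suc j)  ∎
    where
    open ≡-Reasoning
    b = blackInColumn i (suc x)

  stepsOK-∈-≤ : ∀ p xs {z} → T (stepsOK p xs) → z ∈ p ∷ xs → z ≤ p + length xs
  stepsOK-∈-≤ p xs       ok (here refl) = m≤m+n p (length xs)
  stepsOK-∈-≤ p (y ∷ ys) ok (there z∈)  with Equivalence.to T-∧ ok
  ... | y≤1+p , ok′ = begin
    _                    ≤⟨ stepsOK-∈-≤ y ys ok′ z∈ ⟩
    y + length ys        ≤⟨ +-monoˡ-≤ (length ys) (≤ᵇ⇒≤ y (suc p) y≤1+p) ⟩
    suc p + length ys    ≡⟨ +-suc p (length ys) ⟨
    p + length (y ∷ ys)  ∎
    where open ≤-Reasoning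

  isCatalan-∈-< : ∀ w {z} → T (isCatalan w) → z ∈ w → z < length w
  isCatalan-∈-< (x ∷ xs) cat z∈ with Equivalence.to T-∧ cat
  ... | x≡ᵇ0 , ok with ≡ᵇ⇒≡ x 0 x≡ᵇ0
  ... | refl = s≤s (stepsOK-∈-≤ 0 xs ok z∈)

  -- Appending its own last height L keeps w Catalan, and the appended letter L is then
  -- below the new length.
  lastP-≤-length : ∀ x xs → T (isCatalan (x ∷ xs)) → lastP (x ∷ xs) ≤ length (x ∷ xs)
  lastP-≤-length x xs cat = ≤-pred (subst (L <_) (length-∷ʳ (x ∷ xs) L) L<len)
    where
    L = lastP (x ∷ xs)
    extended : T (isCatalan (x ∷ xs ∷ʳ L))
    extended = subst T (sym (isCatalan-∷ʳ x xs L)) (Equivalence.from T-∧ (cat , ≤⇒≤ᵇ (≤-refl {L})))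
    L<len : L < length (x ∷ xs ∷ʳ L)
    L<len = isCatalan-∈-< (x ∷ xs ∷ʳ L) extended (∈-++⁺ʳ (x ∷ xs) (here refl))

  suc-≤ᵇ-suc : ∀ j L → (suc j ≤ᵇ suc L) ≡ (j ≤ᵇ L)
  suc-≤ᵇ-suc zero    L = refl
  suc-≤ᵇ-suc (suc j) L = refl

  parity-suc-==B : ∀ n a → (parity (suc n) ==B not a) ≡ (parity n ==B a)
  parity-suc-==B zero          false = refl
  parity-suc-==B zero          true  = refl
  parity-suc-==B (suc zero)    false = refl
  parity-suc-==B (suc zero)    true  = refl
  parity-suc-==B (suc (suc n)) a     = parity-suc-==B n a

  black-pair : ∀ k → (if parity k then 0 else 1) + (if parity (suc k) then 0 else 1) ≡ 1
  black-pair zero          = refl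
  black-pair (suc zero)    = refl
  black-pair (suc (suc k)) = black-pair k

  blackInColumn-suc-suc : ∀ c h → blackInColumn c (suc (suc h)) ≡ suc (blackInColumn c h)
  blackInColumn-suc-suc c h = begin
    b + cell (c + suc h) + cell (c + suc (suc h))    ≡⟨ +-assoc b _ _ ⟩
    b + (cell (c + suc h) + cell (c + suc (suc h)))
      ≡⟨ cong (λ k → b + (cell (c + suc h) + cell k)) (+-suc c (suc h)) ⟩
    b + (cell (c + suc h) + cell (suc (c + suc h)))  ≡⟨ cong (b +_) (black-pair (c + suc h)) ⟩
    b + 1                                            ≡⟨ +-comm b 1 ⟩
    suc b                                            ∎
    where
    open ≡-Reasoning
    b = blackInColumn c h
    cell : ℕ → ℕ
    cell k = if parity k then 0 else 1

  blackInColumn-suc-1 : ∀ n → blackInColumn (suc n) 1 ≡ (if parity n then 0 else 1)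
  blackInColumn-suc-1 n = cong (λ k → if parity (suc k) then 0 else 1) (+-comm n 1)

module _ {c ℓ} (R : CommutativeRing c ℓ) where
  open CommutativeRing R hiding (zero) renaming (refl to ≈-refl)
  open GF R
  open IntegerCoefficients R
  open import Relation.Binary.Reasoning.Setoid setoid

  𝟙 : Bool → Carrier
  𝟙 false = 0#
  𝟙 true  = 1#

  𝟙-∧ : ∀ a b → 𝟙 (a ∧ b) ≈ 𝟙 a * 𝟙 b
  𝟙-∧ false b = sym (zeroˡ (𝟙 b))
  𝟙-∧ true  b = sym (*-identityˡ (𝟙 b))

  𝟙*-cong : ∀ a {x y} → (T a → x ≈ y) → 𝟙 a * x ≈ 𝟙 a * y
  𝟙*-cong false _   = trans (zeroˡ _) (sym (zeroˡ _))
  𝟙*-cong true  x≈y = *-congˡ (x≈y _)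

  pow-+ : ∀ a m n → pow a (m ℕ.+ n) ≈ pow a m * pow a n
  pow-+ a zero    n = sym (*-identityˡ _)
  pow-+ a (suc m) n = trans (*-congˡ (pow-+ a m n)) (sym (*-assoc a _ _))

  pow-1# : ∀ n → pow 1# n ≈ 1#
  pow-1# zero    = ≈-refl
  pow-1# (suc n) = trans (*-identityˡ _) (pow-1# n)

  uExp-suc-suc : ∀ b h → uExp b (suc (suc h)) ≡ suc (uExp b h)
  uExp-suc-suc false h = refl
  uExp-suc-suc true  h = refl

  alternating-cong : ∀ {a₁ a₂ a₃ a₄ b₁ b₂ b₃ b₄} → a₁ ≈ b₁ → a₂ ≈ b₂ → a₃ ≈ b₃ → a₄ ≈ b₄ →
                     a₁ - a₂ + a₃ - a₄ ≈ b₁ - b₂ + b₃ - b₄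
  alternating-cong e₁ e₂ e₃ e₄ = +-cong (+-cong (+-cong e₁ (-‿cong e₂)) e₃) (-‿cong e₄)

  -- Sums over lists

  ∑ : {A : Set} → (A → Carrier) → List A → Carrier
  ∑ f xs = sumR (map f xs)

  infix 5 ∑
  syntax ∑ (λ x → e) xs = ∑[ x ← xs ] e

  ∑-cong : {A : Set} {f g : A → Carrier} (xs : List A) → (∀ x → f x ≈ g x) → ∑ f xs ≈ ∑ g xs
  ∑-cong []       f≈g = ≈-refl
  ∑-cong (x ∷ xs) f≈g = +-cong (f≈g x) (∑-cong xs f≈g)

  ∑-zero : {A : Set} (xs : List A) → ∑ (λ _ → 0#) xs ≈ 0#
  ∑-zero []       = ≈-refl
  ∑-zero (x ∷ xs) = trans (+-identityˡ _) (∑-zero xs)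

  ∑-++ : {A : Set} (f : A → Carrier) (xs ys : List A) → ∑ f (xs ++ ys) ≈ ∑ f xs + ∑ f ys
  ∑-++ f []       ys = sym (+-identityˡ _)
  ∑-++ f (x ∷ xs) ys = trans (+-congˡ (∑-++ f xs ys)) (sym (+-assoc _ _ _))

  ∑-map : {A B : Set} (f : B → Carrier) (g : A → B) (xs : List A) → ∑ f (map g xs) ≡ ∑ (f ∘ g) xs
  ∑-map f g xs = ≡.cong sumR (≡.sym (map-∘ xs))

  ∑-concatMap : {A B : Set} (f : B → Carrier) (g : A → List B) (xs : List A) →
                ∑ f (concatMap g xs) ≈ ∑[ x ← xs ] ∑ f (g x)
  ∑-concatMap f g []       = ≈-refl
  ∑-concatMap f g (x ∷ xs) = trans (∑-++ f (g x) (concatMap g xs)) (+-congˡ (∑-concatMap f g xs))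

  ∑-filterᵇ : {A : Set} (f : A → Carrier) (p : A → Bool) (xs : List A) →
              ∑ f (filterᵇ p xs) ≈ ∑[ x ← xs ] 𝟙 (p x) * f x
  ∑-filterᵇ f p [] = ≈-refl
  ∑-filterᵇ f p (x ∷ xs) with p x
  ... | true  = +-cong (sym (*-identityˡ _)) (∑-filterᵇ f p xs)
  ... | false = trans (∑-filterᵇ f p xs) (sym (trans (+-congʳ (zeroˡ _)) (+-identityˡ _)))

  *-distribˡ-∑ : {A : Set} (k : Carrier) (f : A → Carrier) (xs : List A) →
                 k * ∑ f xs ≈ ∑[ x ← xs ] k * f x
  *-distribˡ-∑ k f []       = zeroʳ k
  *-distribˡ-∑ k f (x ∷ xs) = trans (distribˡ k _ _) (+-congˡ (*-distribˡ-∑ k f xs))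

  ∑-alternating : {A : Set} (f₁ f₂ f₃ f₄ : A → Carrier) (xs : List A) →
                  ∑ f₁ xs - ∑ f₂ xs + ∑ f₃ xs - ∑ f₄ xs ≈ ∑[ x ← xs ] (f₁ x - f₂ x + f₃ x - f₄ x)
  ∑-alternating f₁ f₂ f₃ f₄ [] =
    solve 0 (con 0ℤ :- con 0ℤ :+ con 0ℤ :- con 0ℤ := con 0ℤ) ≈-refl
  ∑-alternating f₁ f₂ f₃ f₄ (x ∷ xs) =
    trans (regroup _ _ _ _ _ _ _ _) (+-congˡ (∑-alternating f₁ f₂ f₃ f₄ xs))
    where
    regroup : ∀ a₁ a₂ a₃ a₄ s₁ s₂ s₃ s₄ → (a₁ + s₁) - (a₂ + s₂) + (a₃ + s₃) - (a₄ + s₄)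
                                          ≈ (a₁ - a₂ + a₃ - a₄) + (s₁ - s₂ + s₃ - s₄)
    regroup = solve 8 (λ a₁ a₂ a₃ a₄ s₁ s₂ s₃ s₄ → (a₁ :+ s₁) :- (a₂ :+ s₂) :+ (a₃ :+ s₃) :- (a₄ :+ s₄)
                                                   := (a₁ :- a₂ :+ a₃ :- a₄) :+ (s₁ :- s₂ :+ s₃ :- s₄)) ≈-refl

  ∑-upTo-suc : (g : ℕ → Carrier) (N : ℕ) → ∑ g (upTo (suc N)) ≡ g 0 + ∑ (g ∘ suc) (upTo N)
  ∑-upTo-suc g N =
    ≡.cong (λ gs → g 0 + sumR gs) (≡.trans (map-applyUpTo suc g N) (≡.sym (map-upTo (g ∘ suc) N)))

  ∑-two-step-geometric : (x : Carrier) (g : ℕ → Carrier) → (∀ j → g (suc (suc j)) ≈ x * g j) → ∀ N →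
    (x - 1#) * ∑ g (upTo N) ≈ g 0 * (pow x ⌈ N /2⌉ - 1#) + g 1 * (pow x ⌊ N /2⌋ - 1#)
  ∑-two-step-geometric x g rec zero = solve 3 (λ x g₀ g₁ →
    (x :- con 1ℤ) :* con 0ℤ := g₀ :* (con 1ℤ :- con 1ℤ) :+ g₁ :* (con 1ℤ :- con 1ℤ)) ≈-refl x (g 0) (g 1)
  ∑-two-step-geometric x g rec (suc zero) = solve 3 (λ x g₀ g₁ →
    (x :- con 1ℤ) :* (g₀ :+ con 0ℤ) := g₀ :* (x :* con 1ℤ :- con 1ℤ) :+ g₁ :* (con 1ℤ :- con 1ℤ)) ≈-refl x (g 0) (g 1)
  ∑-two-step-geometric x g rec (suc (suc N)) = begin
    (x - 1#) * ∑ g (upTo (suc (suc N)))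
      ≡⟨ ≡.cong ((x - 1#) *_) (≡.trans (∑-upTo-suc g (suc N)) (≡.cong (g 0 +_) (∑-upTo-suc (g ∘ suc) N))) ⟩
    (x - 1#) * (g 0 + (g 1 + ∑ (g ∘ suc ∘ suc) (upTo N)))
      ≈⟨ *-congˡ (+-congˡ (+-congˡ (trans (∑-cong (upTo N) rec) (sym (*-distribˡ-∑ x g (upTo N)))))) ⟩
    (x - 1#) * (g 0 + (g 1 + x * S))
      ≈⟨ expand x (g 0) (g 1) S ⟩
    (x - 1#) * g 0 + (x - 1#) * g 1 + x * ((x - 1#) * S)
      ≈⟨ +-congˡ (*-congˡ (∑-two-step-geometric x g rec N)) ⟩
    (x - 1#) * g 0 + (x - 1#) * g 1 + x * (g 0 * (pow x ⌈ N /2⌉ - 1#) + g 1 * (pow x ⌊ N /2⌋ - 1#))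
      ≈⟨ collect x (g 0) (g 1) (pow x ⌈ N /2⌉) (pow x ⌊ N /2⌋) ⟩
    g 0 * (x * pow x ⌈ N /2⌉ - 1#) + g 1 * (x * pow x ⌊ N /2⌋ - 1#) ∎
    where
    S = ∑ g (upTo N)
    expand : ∀ x g₀ g₁ S → (x - 1#) * (g₀ + (g₁ + x * S))
                           ≈ (x - 1#) * g₀ + (x - 1#) * g₁ + x * ((x - 1#) * S)
    expand = solve 4 (λ x g₀ g₁ S → (x :- con 1ℤ) :* (g₀ :+ (g₁ :+ x :* S))
                     := (x :- con 1ℤ) :* g₀ :+ (x :- con 1ℤ) :* g₁ :+ x :* ((x :- con 1ℤ) :* S)) ≈-refl
    collect : ∀ x g₀ g₁ P Q → (x - 1#) * g₀ + (x - 1#) * g₁ + x * (g₀ * (P - 1#) + g₁ * (Q - 1#))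
                             ≈ g₀ * (x * P - 1#) + g₁ * (x * Q - 1#)
    collect = solve 5 (λ x g₀ g₁ P Q →
      (x :- con 1ℤ) :* g₀ :+ (x :- con 1ℤ) :* g₁ :+ x :* (g₀ :* (P :- con 1ℤ) :+ g₁ :* (Q :- con 1ℤ))
      := g₀ :* (x :* P :- con 1ℤ) :+ g₁ :* (x :* Q :- con 1ℤ)) ≈-refl

  ∑-upTo-≤ᵇ : ∀ (g : ℕ → Carrier) L M → L < M → ∑[ j ← upTo M ] 𝟙 (j ≤ᵇ L) * g j ≈ ∑ g (upTo (suc L))
  ∑-upTo-≤ᵇ g zero (suc M) _ = begin
    ∑[ j ← upTo (suc M) ] 𝟙 (j ≤ᵇ 0) * g j
      ≡⟨ ∑-upTo-suc _ M ⟩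
    1# * g 0 + (∑[ j ← upTo M ] 0# * g (suc j))
      ≈⟨ +-cong (*-identityˡ (g 0)) (trans (∑-cong (upTo M) (λ j → zeroˡ _)) (∑-zero (upTo M))) ⟩
    g 0 + 0# ∎
  ∑-upTo-≤ᵇ g (suc L) (suc M) (s≤s L<M) = begin
    ∑[ j ← upTo (suc M) ] 𝟙 (j ≤ᵇ suc L) * g j
      ≡⟨ ∑-upTo-suc _ M ⟩
    1# * g 0 + (∑[ j ← upTo M ] 𝟙 (suc j ≤ᵇ suc L) * g (suc j))
      ≈⟨ +-cong (*-identityˡ (g 0))
                (∑-cong (upTo M) (λ j → reflexive (≡.cong (λ b → 𝟙 b * g (suc j)) (suc-≤ᵇ-suc j L)))) ⟩
    g 0 + (∑[ j ← upTo M ] 𝟙 (j ≤ᵇ L) * g (suc j))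
      ≈⟨ +-congˡ (∑-upTo-≤ᵇ (g ∘ suc) L M L<M) ⟩
    g 0 + ∑ (g ∘ suc) (upTo (suc L))
      ≡⟨ ∑-upTo-suc g (suc L) ⟨
    ∑ g (upTo (suc (suc L))) ∎

  -- Sums over words

  ∑-allWords-suc : ∀ n M (f : List ℕ → Carrier) →
    ∑ f (allWords (suc n) M) ≈ ∑[ k ← upTo M ] ∑[ v ← allWords n M ] f (k ∷ v)
  ∑-allWords-suc n M f =
    trans (∑-concatMap f _ (upTo M)) (∑-cong (upTo M) (λ k → reflexive (∑-map f (k ∷_) (allWords n M))))

  ∑-allWords-cong : ∀ n M {f g : List ℕ → Carrier} → (∀ w → length w ≡ n → f w ≈ g w) →
    ∑ f (allWords n M) ≈ ∑ g (allWords n M)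
  ∑-allWords-cong zero    M f≈g = +-congʳ (f≈g [] refl)
  ∑-allWords-cong (suc n) M {f} {g} f≈g = begin
    ∑ f (allWords (suc n) M)
      ≈⟨ ∑-allWords-suc n M f ⟩
    ∑[ k ← upTo M ] ∑[ v ← allWords n M ] f (k ∷ v)
      ≈⟨ ∑-cong (upTo M) (λ k → ∑-allWords-cong n M (λ v |v| → f≈g (k ∷ v) (≡.cong suc |v|))) ⟩
    ∑[ k ← upTo M ] ∑[ v ← allWords n M ] g (k ∷ v)
      ≈⟨ ∑-allWords-suc n M g ⟨
    ∑ g (allWords (suc n) M) ∎

  ∑-allWords-∷ʳ : ∀ n M (f : List ℕ → Carrier) →
    ∑ f (allWords (suc n) M) ≈ ∑[ w ← allWords n M ] ∑[ j ← upTo M ] f (w ∷ʳ j)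
  ∑-allWords-∷ʳ zero M f = trans (∑-allWords-suc zero M f)
    (trans (∑-cong (upTo M) (λ k → +-identityʳ (f [ k ]))) (sym (+-identityʳ _)))
  ∑-allWords-∷ʳ (suc n) M f = begin
    ∑ f (allWords (suc (suc n)) M)
      ≈⟨ ∑-allWords-suc (suc n) M f ⟩
    ∑[ k ← upTo M ] ∑[ v ← allWords (suc n) M ] f (k ∷ v)
      ≈⟨ ∑-cong (upTo M) (λ k → ∑-allWords-∷ʳ n M (f ∘ (k ∷_))) ⟩
    ∑[ k ← upTo M ] ∑[ w ← allWords n M ] ∑[ j ← upTo M ] f (k ∷ w ∷ʳ j)
      ≈⟨ ∑-allWords-suc n M _ ⟨
    ∑[ w ← allWords (suc n) M ] ∑[ j ← upTo M ] f (w ∷ʳ j) ∎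

  ∑-allWords-bound : ∀ n M (f : List ℕ → Carrier) → (∀ w → length w ≡ n → M ∈ w → f w ≈ 0#) →
    ∑ f (allWords n (suc M)) ≈ ∑ f (allWords n M)
  ∑-allWords-bound zero    M f vanish = ≈-refl
  ∑-allWords-bound (suc n) M f vanish = begin
    ∑ f (allWords (suc n) (suc M))  ≈⟨ ∑-allWords-suc n (suc M) f ⟩
    ∑ F (upTo (suc M))              ≡⟨ ≡.cong (∑ F) (upTo-∷ʳ M) ⟨
    ∑ F (upTo M ∷ʳ M)               ≈⟨ ∑-++ F (upTo M) [ M ] ⟩
    ∑ F (upTo M) + (F M + 0#)       ≈⟨ +-cong (∑-cong (upTo M) shrink) (trans (+-identityʳ (F M)) F[M]≈0) ⟩
    S + 0#                          ≈⟨ +-identityʳ S ⟩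
    S                               ≈⟨ ∑-allWords-suc n M f ⟨
    ∑ f (allWords (suc n) M)        ∎
    where
    F : ℕ → Carrier
    F k = ∑[ v ← allWords n (suc M) ] f (k ∷ v)
    S : Carrier
    S = ∑[ k ← upTo M ] ∑[ v ← allWords n M ] f (k ∷ v)
    shrink : ∀ k → F k ≈ ∑[ v ← allWords n M ] f (k ∷ v)
    shrink k = ∑-allWords-bound n M (f ∘ (k ∷_)) (λ v |v| M∈v → vanish (k ∷ v) (≡.cong suc |v|) (there M∈v))
    F[M]≈0 : F M ≈ 0#
    F[M]≈0 = trans (∑-allWords-cong n (suc M) (λ v |v| → vanish (M ∷ v) (≡.cong suc |v|) (here refl)))
                   (∑-zero (allWords n (suc M)))

  ∑-catalanWords-∷ʳ : ∀ n (f : List ℕ → Carrier) →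
    ∑ f (catalanWords (suc (suc n))) ≈ ∑[ w ← catalanWords (suc n) ] ∑[ j ← upTo (suc (lastP w)) ] f (w ∷ʳ j)
  ∑-catalanWords-∷ʳ n f = begin
    ∑ f (catalanWords (suc N))
      ≈⟨ ∑-filterᵇ f isCatalan (allWords (suc N) (suc N)) ⟩
    ∑[ v ← allWords (suc N) (suc N) ] 𝟙 (isCatalan v) * f v
      ≈⟨ ∑-allWords-∷ʳ N (suc N) (λ v → 𝟙 (isCatalan v) * f v) ⟩
    ∑[ w ← allWords N (suc N) ] ∑[ j ← upTo (suc N) ] 𝟙 (isCatalan (w ∷ʳ j)) * f (w ∷ʳ j)
      ≈⟨ ∑-allWords-cong N (suc N) extend ⟩
    ∑[ w ← allWords N (suc N) ] 𝟙 (isCatalan w) * E w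
      ≈⟨ ∑-allWords-bound N N (λ w → 𝟙 (isCatalan w) * E w) nonCatalan ⟩
    ∑[ w ← allWords N N ] 𝟙 (isCatalan w) * E w
      ≈⟨ ∑-filterᵇ E isCatalan (allWords N N) ⟨
    ∑ E (catalanWords N) ∎
    where
    N = suc n
    E : List ℕ → Carrier
    E w = ∑[ j ← upTo (suc (lastP w)) ] f (w ∷ʳ j)
    extend : ∀ w → length w ≡ N →
             ∑[ j ← upTo (suc N) ] 𝟙 (isCatalan (w ∷ʳ j)) * f (w ∷ʳ j) ≈ 𝟙 (isCatalan w) * E w
    extend (x ∷ xs) |w| = begin
      ∑[ j ← upTo (suc N) ] 𝟙 (isCatalan (w ∷ʳ j)) * f (w ∷ʳ j)
        ≈⟨ ∑-cong (upTo (suc N)) (λ j → trans (*-congʳ (split j)) (*-assoc _ _ _)) ⟩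
      ∑[ j ← upTo (suc N) ] 𝟙 (isCatalan w) * (𝟙 (j ≤ᵇ L) * f (w ∷ʳ j))
        ≈⟨ *-distribˡ-∑ (𝟙 (isCatalan w)) _ (upTo (suc N)) ⟨
      𝟙 (isCatalan w) * (∑[ j ← upTo (suc N) ] 𝟙 (j ≤ᵇ L) * f (w ∷ʳ j))
        ≈⟨ 𝟙*-cong (isCatalan w) (λ cat → ∑-upTo-≤ᵇ _ L (suc N) (L<1+N cat)) ⟩
      𝟙 (isCatalan w) * E w ∎
      where
      w = x ∷ xs
      L = lastP w
      L<1+N : T (isCatalan w) → L < suc N
      L<1+N cat = s≤s (≡.subst (L ℕ.≤_) |w| (lastP-≤-length x xs cat))
      split : ∀ j → 𝟙 (isCatalan (w ∷ʳ j)) ≈ 𝟙 (isCatalan w) * 𝟙 (j ≤ᵇ L)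
      split j = trans (reflexive (≡.cong 𝟙 (isCatalan-∷ʳ x xs j))) (𝟙-∧ (isCatalan w) (j ≤ᵇ L))
    nonCatalan : ∀ w → length w ≡ N → N ∈ w → 𝟙 (isCatalan w) * E w ≈ 0#
    nonCatalan w |w| N∈w = trans
      (𝟙*-cong (isCatalan w) (λ cat → ⊥-elim (<-irrefl (≡.sym |w|) (isCatalan-∈-< w cat N∈w))))
      (zeroʳ _)

  -- Weights of Catalan polyominoes

  module _ (u q : Carrier) where
    open import Algebra.Properties.CommutativeSemigroup *-commutativeSemigroup using (x∙yz≈y∙xz)

    weight : Bool → Bool → Carrier → List ℕ → Carrier
    weight a b X w =
      𝟙 ((parity (len w) ==B a) ∧ (parity (lastP w) ==B b)) * (pow X (uExp b (lastP w)) * pow q (bck w))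

    qWeight : Bool → List ℕ → Carrier
    qWeight a w = 𝟙 (parity (len w) ==B a) * pow q (bck w)

    uWeight : Bool → Carrier → ℕ → Carrier
    uWeight b X L = 𝟙 (parity L ==B b) * pow X (uExp b L)

    columnWeight : Bool → ℕ → ℕ → Carrier
    columnWeight b c h = uWeight b u h * pow q (blackInColumn c h)

    G-∑ : ∀ a b n X → G a b n X q ≈ ∑ (weight a b X) (catalanWords n)
    G-∑ a b n X = ∑-filterᵇ _ _ (catalanWords n)

    weight-split : ∀ a b X w → weight a b X w ≈ qWeight a w * uWeight b X (lastP w)
    weight-split a b X w = trans (*-congʳ (𝟙-∧ (parity (len w) ==B a) (parity (lastP w) ==B b))) (regroup _ _ _ _)
      where
      regroup : ∀ e o U Q → e * o * (U * Q) ≈ e * Q * (o * U)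
      regroup = solve 4 (λ e o U Q → e :* o :* (U :* Q) := e :* Q :* (o :* U)) ≈-refl

    uWeight-sum : ∀ X L → uWeight false X L + uWeight true X L ≈ pow X ⌈ L /2⌉
    uWeight-sum X zero =
      solve 0 (con 1ℤ :* con 1ℤ :+ con 0ℤ :* con 1ℤ := con 1ℤ) ≈-refl
    uWeight-sum X (suc zero) =
      solve 1 (λ X → con 0ℤ :* con 1ℤ :+ con 1ℤ :* (X :* con 1ℤ) := X :* con 1ℤ) ≈-refl X
    uWeight-sum X (suc (suc L)) = trans (factor _ _ X _ _) (*-congˡ (uWeight-sum X L))
      where
      factor : ∀ e o X P Q → e * (X * P) + o * (X * Q) ≈ X * (e * P + o * Q)
      factor = solve 5 (λ e o X P Q → e :* (X :* P) :+ o :* (X :* Q) := X :* (e :* P :+ o :* Q)) ≈-refl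

    uWeight-sum-shifted : ∀ X L → X * uWeight false X L + uWeight true X L ≈ pow X ⌈ suc L /2⌉
    uWeight-sum-shifted X L = begin
      X * (𝟙 (parity L ==B false) * pow X ⌊ L /2⌋) + 𝟙 (parity L ==B true) * pow X ⌊ suc L /2⌋
        ≈⟨ swap _ _ X _ _ ⟩
      𝟙 (parity L ==B true) * pow X ⌊ suc L /2⌋ + 𝟙 (parity L ==B false) * (X * pow X ⌊ L /2⌋)
        ≡⟨ ≡.cong₂ (λ e o → 𝟙 e * pow X ⌊ suc L /2⌋ + 𝟙 o * (X * pow X ⌊ L /2⌋))
                   (parity-suc-==B L true) (parity-suc-==B L false) ⟨
      uWeight false X (suc L) + uWeight true X (suc L)
        ≈⟨ uWeight-sum X (suc L) ⟩
      pow X ⌈ suc L /2⌉ ∎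
      where
      swap : ∀ e o X P Q → X * (e * P) + o * Q ≈ o * Q + e * (X * P)
      swap = solve 5 (λ e o X P Q → X :* (e :* P) :+ o :* Q := o :* Q :+ e :* (X :* P)) ≈-refl

    G-difference-even : ∀ a m →
      G a false m (q * u) q - G a false m 1# q + G a true m (q * u) q - G a true m 1# q
        ≈ ∑[ w ← catalanWords m ] qWeight a w * (pow (q * u) ⌈ lastP w /2⌉ - 1#)
    G-difference-even a m = begin
      G a false m (q * u) q - G a false m 1# q + G a true m (q * u) q - G a true m 1# q
        ≈⟨ alternating-cong (G-∑ a false m (q * u)) (G-∑ a false m 1#) (G-∑ a true m (q * u)) (G-∑ a true m 1#) ⟩
      ∑ (weight a false (q * u)) ws - ∑ (weight a false 1#) ws
        + ∑ (weight a true (q * u)) ws - ∑ (weight a true 1#) ws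
        ≈⟨ ∑-alternating _ _ _ _ ws ⟩
      ∑[ w ← ws ] (weight a false (q * u) w - weight a false 1# w + weight a true (q * u) w - weight a true 1# w)
        ≈⟨ ∑-cong ws perWord ⟩
      ∑[ w ← ws ] qWeight a w * (pow (q * u) ⌈ lastP w /2⌉ - 1#) ∎
      where
      ws = catalanWords m
      perWord : ∀ w → weight a false (q * u) w - weight a false 1# w + weight a true (q * u) w - weight a true 1# w
                      ≈ qWeight a w * (pow (q * u) ⌈ lastP w /2⌉ - 1#)
      perWord w = begin
        _ ≈⟨ alternating-cong (weight-split a false (q * u) w) (weight-split a false 1# w)
                              (weight-split a true (q * u) w) (weight-split a true 1# w) ⟩
        Q * uWeight false (q * u) L - Q * uWeight false 1# L + Q * uWeight true (q * u) L - Q * uWeight true 1# L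
          ≈⟨ collect Q _ _ _ _ ⟩
        Q * ((uWeight false (q * u) L + uWeight true (q * u) L) - (uWeight false 1# L + uWeight true 1# L))
          ≈⟨ *-congˡ (+-cong (uWeight-sum (q * u) L) (-‿cong (trans (uWeight-sum 1# L) (pow-1# ⌈ L /2⌉)))) ⟩
        Q * (pow (q * u) ⌈ L /2⌉ - 1#) ∎
        where
        Q = qWeight a w
        L = lastP w
        collect : ∀ Q A B C D → Q * A - Q * B + Q * C - Q * D ≈ Q * ((A + C) - (B + D))
        collect = solve 5 (λ Q A B C D → Q :* A :- Q :* B :+ Q :* C :- Q :* D
                                         := Q :* ((A :+ C) :- (B :+ D))) ≈-refl

    G-difference-odd : ∀ a m →
      u * q * G a false m (q * u) q - G a false m 1# q + G a true m (q * u) q - G a true m 1# q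
        ≈ ∑[ w ← catalanWords m ] qWeight a w * (pow (q * u) ⌈ suc (lastP w) /2⌉ - 1#)
    G-difference-odd a m = begin
      u * q * G a false m (q * u) q - G a false m 1# q + G a true m (q * u) q - G a true m 1# q
        ≈⟨ alternating-cong (trans (*-congˡ (G-∑ a false m (q * u))) (*-distribˡ-∑ (u * q) _ ws))
                            (G-∑ a false m 1#) (G-∑ a true m (q * u)) (G-∑ a true m 1#) ⟩
      (∑[ w ← ws ] u * q * weight a false (q * u) w) - ∑ (weight a false 1#) ws
        + ∑ (weight a true (q * u)) ws - ∑ (weight a true 1#) ws
        ≈⟨ ∑-alternating _ _ _ _ ws ⟩
      ∑[ w ← ws ] (u * q * weight a false (q * u) w - weight a false 1# w
                   + weight a true (q * u) w - weight a true 1# w)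
        ≈⟨ ∑-cong ws perWord ⟩
      ∑[ w ← ws ] qWeight a w * (pow (q * u) ⌈ suc (lastP w) /2⌉ - 1#) ∎
      where
      ws = catalanWords m
      perWord : ∀ w → u * q * weight a false (q * u) w - weight a false 1# w
                      + weight a true (q * u) w - weight a true 1# w
                      ≈ qWeight a w * (pow (q * u) ⌈ suc (lastP w) /2⌉ - 1#)
      perWord w = begin
        _ ≈⟨ alternating-cong (*-congˡ (weight-split a false (q * u) w)) (weight-split a false 1# w)
                              (weight-split a true (q * u) w) (weight-split a true 1# w) ⟩
        u * q * (Q * uWeight false (q * u) L) - Q * uWeight false 1# L
          + Q * uWeight true (q * u) L - Q * uWeight true 1# L
          ≈⟨ collect u q Q _ _ _ _ ⟩
        Q * ((q * u * uWeight false (q * u) L + uWeight true (q * u) L) - (uWeight false 1# L + uWeight true 1# L))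
          ≈⟨ *-congˡ (+-cong (uWeight-sum-shifted (q * u) L)
                             (-‿cong (trans (uWeight-sum 1# L) (pow-1# ⌈ L /2⌉)))) ⟩
        Q * (pow (q * u) ⌈ suc L /2⌉ - 1#) ∎
        where
        Q = qWeight a w
        L = lastP w
        collect : ∀ u q Q A B C D → u * q * (Q * A) - Q * B + Q * C - Q * D ≈ Q * ((q * u * A + C) - (B + D))
        collect = solve 7 (λ u q Q A B C D → u :* q :* (Q :* A) :- Q :* B :+ Q :* C :- Q :* D
                                             := Q :* ((q :* u :* A :+ C) :- (B :+ D))) ≈-refl

    columnWeight-suc-suc : ∀ b c h → columnWeight b c (suc (suc h)) ≈ q * u * columnWeight b c h
    columnWeight-suc-suc b c h rewrite uExp-suc-suc b h | blackInColumn-suc-suc c h = regroup _ _ _ _ _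
      where
      regroup : ∀ e u U q C → e * (u * U) * (q * C) ≈ q * u * (e * U * C)
      regroup = solve 5 (λ e u U q C → e :* (u :* U) :* (q :* C) := q :* u :* (e :* U :* C)) ≈-refl

    columnSum-even : ∀ c L → (q * u - 1#) * (∑[ j ← upTo (suc L) ] columnWeight false c (suc j))
                               ≈ u * q * (pow (q * u) ⌈ L /2⌉ - 1#)
    columnSum-even c L = begin
      (q * u - 1#) * (∑[ j ← upTo (suc L) ] columnWeight false c (suc j))
        ≈⟨ ∑-two-step-geometric (q * u) _ (λ j → columnWeight-suc-suc false c (suc j)) (suc L) ⟩
      0# * 1# * pow q (blackInColumn c 1) * (pow (q * u) ⌈ suc L /2⌉ - 1#)
        + 1# * (u * 1#) * pow q (blackInColumn c 2) * (pow (q * u) ⌈ L /2⌉ - 1#)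
        ≈⟨ +-congˡ (*-congʳ (*-congˡ (reflexive (≡.cong (pow q) (blackInColumn-suc-suc c 0))))) ⟩
      0# * 1# * pow q (blackInColumn c 1) * (pow (q * u) ⌈ suc L /2⌉ - 1#)
        + 1# * (u * 1#) * (q * 1#) * (pow (q * u) ⌈ L /2⌉ - 1#)
        ≈⟨ simplify u q _ _ _ ⟩
      u * q * (pow (q * u) ⌈ L /2⌉ - 1#) ∎
      where
      simplify : ∀ u q B P P′ → 0# * 1# * B * (P - 1#) + 1# * (u * 1#) * (q * 1#) * (P′ - 1#)
                                ≈ u * q * (P′ - 1#)
      simplify = solve 5 (λ u q B P P′ → con 0ℤ :* con 1ℤ :* B :* (P :- con 1ℤ)
                                          :+ con 1ℤ :* (u :* con 1ℤ) :* (q :* con 1ℤ) :* (P′ :- con 1ℤ)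
                                          := u :* q :* (P′ :- con 1ℤ)) ≈-refl

    columnSum-odd : ∀ c L → (q * u - 1#) * (∑[ j ← upTo (suc L) ] columnWeight true c (suc j))
                              ≈ u * pow q (blackInColumn c 1) * (pow (q * u) ⌈ suc L /2⌉ - 1#)
    columnSum-odd c L = trans
      (∑-two-step-geometric (q * u) _ (λ j → columnWeight-suc-suc true c (suc j)) (suc L))
      (simplify u _ _ _ _)
      where
      simplify : ∀ u B C P P′ → 1# * (u * 1#) * B * (P - 1#) + 0# * (u * 1#) * C * (P′ - 1#)
                                ≈ u * B * (P - 1#)
      simplify = solve 5 (λ u B C P P′ → con 1ℤ :* (u :* con 1ℤ) :* B :* (P :- con 1ℤ)
                                          :+ con 0ℤ :* (u :* con 1ℤ) :* C :* (P′ :- con 1ℤ)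
                                          := u :* B :* (P :- con 1ℤ)) ≈-refl

    weight-∷ʳ : ∀ a b w j → weight (not a) b u (w ∷ʳ j) ≈ qWeight a w * columnWeight b (suc (len w)) (suc j)
    weight-∷ʳ a b w j rewrite length-∷ʳ w j | lastP-∷ʳ w j | bckFrom-∷ʳ 1 w j | parity-suc-==B (len w) a =
      trans (*-cong (𝟙-∧ (parity (len w) ==B a) (parity (suc j) ==B b)) (*-congˡ (pow-+ q (bck w) _)))
            (regroup _ _ _ _ _)
      where
      regroup : ∀ e o U Q C → e * o * (U * (Q * C)) ≈ e * Q * (o * U * C)
      regroup = solve 5 (λ e o U Q C → e :* o :* (U :* (Q :* C)) := e :* Q :* (o :* U :* C)) ≈-refl

    extension-∑ : ∀ a b w →
      (q * u - 1#) * (∑[ j ← upTo (suc (lastP w)) ] weight (not a) b u (w ∷ʳ j))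
        ≈ qWeight a w * ((q * u - 1#) * (∑[ j ← upTo (suc (lastP w)) ] columnWeight b (suc (len w)) (suc j)))
    extension-∑ a b w =
      trans (*-congˡ (trans (∑-cong js (weight-∷ʳ a b w)) (sym (*-distribˡ-∑ (qWeight a w) _ js))))
            (x∙yz≈y∙xz _ _ _)
      where js = upTo (suc (lastP w))

    extension-even : ∀ a w →
      (q * u - 1#) * (∑[ j ← upTo (suc (lastP w)) ] weight (not a) false u (w ∷ʳ j))
        ≈ u * q * (qWeight a w * (pow (q * u) ⌈ lastP w /2⌉ - 1#))
    extension-even a w = trans (extension-∑ a false w)
      (trans (*-congˡ (columnSum-even (suc (len w)) (lastP w))) (x∙yz≈y∙xz _ _ _))

    -- u q^β with β = 1 iff the bottom cell of a column appended to a word of length parity a is black.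
    bottomFactor : Bool → Carrier
    bottomFactor true  = u
    bottomFactor false = u * q

    bottomFactor-parity : ∀ n a → T (parity n ==B a) → u * pow q (blackInColumn (suc n) 1) ≈ bottomFactor a
    bottomFactor-parity n a n≡a rewrite blackInColumn-suc-1 n with parity n
    bottomFactor-parity n true  _  | true  = *-identityʳ u
    bottomFactor-parity n false () | true
    bottomFactor-parity n true  () | false
    bottomFactor-parity n false _  | false = *-congˡ (*-identityʳ q)

    extension-odd : ∀ a w →
      (q * u - 1#) * (∑[ j ← upTo (suc (lastP w)) ] weight (not a) true u (w ∷ʳ j))
        ≈ bottomFactor a * (qWeight a w * (pow (q * u) ⌈ suc (lastP w) /2⌉ - 1#))
    extension-odd a w = begin
      _ ≈⟨ trans (extension-∑ a true w) (*-congˡ (columnSum-odd (suc (len w)) (lastP w))) ⟩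
      𝟙 e * pow q (bck w) * (u * pow q (blackInColumn (suc (len w)) 1) * D)
        ≈⟨ regroup _ _ _ _ ⟩
      𝟙 e * (u * pow q (blackInColumn (suc (len w)) 1) * (pow q (bck w) * D))
        ≈⟨ 𝟙*-cong e (λ |w|≡a → *-congʳ (bottomFactor-parity (len w) a |w|≡a)) ⟩
      𝟙 e * (bottomFactor a * (pow q (bck w) * D))
        ≈⟨ x∙yz≈y∙xz _ _ _ ⟩
      bottomFactor a * (𝟙 e * (pow q (bck w) * D))
        ≈⟨ *-congˡ (sym (*-assoc _ _ _)) ⟩
      bottomFactor a * (qWeight a w * D) ∎
      where
      e = parity (len w) ==B a
      D = pow (q * u) ⌈ suc (lastP w) /2⌉ - 1#
      regroup : ∀ e Q B D → e * Q * (B * D) ≈ e * (B * (Q * D))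
      regroup = solve 4 (λ e Q B D → e :* Q :* (B :* D) := e :* (B :* (Q :* D))) ≈-refl

    G-extensions : ∀ a b n →
      (q * u - 1#) * G a b (suc (suc n)) u q
        ≈ ∑[ w ← catalanWords (suc n) ] (q * u - 1#) * (∑[ j ← upTo (suc (lastP w)) ] weight a b u (w ∷ʳ j))
    G-extensions a b n = trans
      (*-congˡ (trans (G-∑ a b (suc (suc n)) u) (∑-catalanWords-∷ʳ n (weight a b u))))
      (*-distribˡ-∑ (q * u - 1#) _ (catalanWords (suc n)))

    even-equation : ∀ a n →
      (q * u - 1#) * G (not a) false (suc (suc n)) u q
        ≈ u * q * (G a false (suc n) (q * u) q - G a false (suc n) 1# q
                   + G a true (suc n) (q * u) q - G a true (suc n) 1# q)
    even-equation a n = begin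
      (q * u - 1#) * G (not a) false (suc (suc n)) u q
        ≈⟨ G-extensions (not a) false n ⟩
      ∑[ w ← ws ] (q * u - 1#) * (∑[ j ← upTo (suc (lastP w)) ] weight (not a) false u (w ∷ʳ j))
        ≈⟨ ∑-cong ws (extension-even a) ⟩
      ∑[ w ← ws ] u * q * (qWeight a w * (pow (q * u) ⌈ lastP w /2⌉ - 1#))
        ≈⟨ *-distribˡ-∑ (u * q) _ ws ⟨
      u * q * (∑[ w ← ws ] qWeight a w * (pow (q * u) ⌈ lastP w /2⌉ - 1#))
        ≈⟨ *-congˡ (G-difference-even a (suc n)) ⟨
      u * q * (G a false (suc n) (q * u) q - G a false (suc n) 1# q
               + G a true (suc n) (q * u) q - G a true (suc n) 1# q) ∎
      where ws = catalanWords (suc n)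

    odd-equation : ∀ a n →
      (q * u - 1#) * G (not a) true (suc (suc n)) u q
        ≈ bottomFactor a * (u * q * G a false (suc n) (q * u) q - G a false (suc n) 1# q
                            + G a true (suc n) (q * u) q - G a true (suc n) 1# q)
    odd-equation a n = begin
      (q * u - 1#) * G (not a) true (suc (suc n)) u q
        ≈⟨ G-extensions (not a) true n ⟩
      ∑[ w ← ws ] (q * u - 1#) * (∑[ j ← upTo (suc (lastP w)) ] weight (not a) true u (w ∷ʳ j))
        ≈⟨ ∑-cong ws (extension-odd a) ⟩
      ∑[ w ← ws ] bottomFactor a * (qWeight a w * (pow (q * u) ⌈ suc (lastP w) /2⌉ - 1#))
        ≈⟨ *-distribˡ-∑ (bottomFactor a) _ ws ⟨
      bottomFactor a * (∑[ w ← ws ] qWeight a w * (pow (q * u) ⌈ suc (lastP w) /2⌉ - 1#))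
        ≈⟨ *-congˡ (G-difference-odd a (suc n)) ⟨
      bottomFactor a * (u * q * G a false (suc n) (q * u) q - G a false (suc n) 1# q
                        + G a true (suc n) (q * u) q - G a true (suc n) 1# q) ∎
      where ws = catalanWords (suc n)

    -- The only Catalan word of length one is 0; these are the four equations at n = 1 after reduction.
    length-one : (q * u - 1#) * 0# ≈ u * q * (0# - 0# + 0# - 0#)
               × (q * u - 1#) * 0# ≈ u * (u * q * 0# - 0# + 0# - 0#)
               × (q * u - 1#) * 0# ≈ u * q * (0# - 0# + 0# - 0#)
               × (q * u - 1#) * ((u * 1#) * (q * 1#) + 0#)
                   ≈ (q * u - 1#) * (u * q) + u * q * (u * q * 0# - 0# + 0# - 0#)
    length-one = vanish₁ u q , vanish₂ u q , vanish₁ u q , single u q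
      where
      vanish₁ : ∀ u q → (q * u - 1#) * 0# ≈ u * q * (0# - 0# + 0# - 0#)
      vanish₁ = solve 2 (λ u q → (q :* u :- con 1ℤ) :* con 0ℤ
                                 := u :* q :* (con 0ℤ :- con 0ℤ :+ con 0ℤ :- con 0ℤ)) ≈-refl
      vanish₂ : ∀ u q → (q * u - 1#) * 0# ≈ u * (u * q * 0# - 0# + 0# - 0#)
      vanish₂ = solve 2 (λ u q → (q :* u :- con 1ℤ) :* con 0ℤ
                                 := u :* (u :* q :* con 0ℤ :- con 0ℤ :+ con 0ℤ :- con 0ℤ)) ≈-refl
      single : ∀ u q → (q * u - 1#) * ((u * 1#) * (q * 1#) + 0#)
                       ≈ (q * u - 1#) * (u * q) + u * q * (u * q * 0# - 0# + 0# - 0#)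
      single = solve 2 (λ u q → (q :* u :- con 1ℤ) :* ((u :* con 1ℤ) :* (q :* con 1ℤ) :+ con 0ℤ)
                                := (q :* u :- con 1ℤ) :* (u :* q)
                                   :+ u :* q :* (u :* q :* con 0ℤ :- con 0ℤ :+ con 0ℤ :- con 0ℤ)) ≈-refl

theorem2p2 : ∀ {c ℓ} (R : CommutativeRing c ℓ) →
    let open CommutativeRing R
        open GF R
    in (u q : Carrier) (n : ℕ) →
         ((q * u - 1#) * G false false n u q
            ≈ xTimes (λ m → u * q * (G true false m (q * u) q - G true false m 1# q
                                     + G true true m (q * u) q - G true true m 1# q)) n)
       × ((q * u - 1#) * G false true n u q
            ≈ xTimes (λ m → u * (u * q * G true false m (q * u) q - G true false m 1# q
                                 + G true true m (q * u) q - G true true m 1# q)) n)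
       × ((q * u - 1#) * G true false n u q
            ≈ xTimes (λ m → u * q * (G false false m (q * u) q - G false false m 1# q
                                     + G false true m (q * u) q - G false true m 1# q)) n)
       × ((q * u - 1#) * G true true n u q
            ≈ (q * u - 1#) * xMono (u * q) n
              + xTimes (λ m → u * q * (u * q * G false false m (q * u) q - G false false m 1# q
                                       + G false true m (q * u) q - G false true m 1# q)) n)
theorem2p2 R u q zero = zeroʳ _ , zeroʳ _ , zeroʳ _ , sym (+-identityʳ _)
  where open CommutativeRing R
theorem2p2 R u q (suc zero) = length-one R u q
theorem2p2 R u q (suc (suc n)) =
  even-equation R u q true n , odd-equation R u q true n , even-equation R u q false n ,
  trans (odd-equation R u q false n) (sym (trans (+-congʳ (zeroʳ _)) (+-identityˡ _)))
  where open CommutativeRing R
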